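{- Let $n,k\ge0$ and let $\lambda/\mu$ be a horizontal strip with $\lambda\vdash n$. Then: (a) If $k=0$, then $\mathcal{E}_{\lambda/\mu}(k)=1$. (b) If $k>0$ and $\mu=\lambda$, then $\mathcal{E}_{\lambda/\mu}(k)=0$. (c) If $k>0$ and $\mu\ne\lambda$, then $$\mathcal{E}_{\lambda/\mu}(k)=q^k\,\mathcal{E}_{\lambda'/\mu}(k)+[n+1-k+c]_q\,\mathcal{E}_{\lambda'/\mu}(k-1),$$ where $\lambda'\vdash n-1$ is obtained from $\lambda$ by removing the cell of $\lambda/\mu$ containing $n$ in the filling $\mathfrak{t}^{\lambda/\mu}$, and $c$ is the content of that cell.
   Context: Partitions are drawn as Young diagrams in English notation; the cell in row $i$, column $j$ has content $j-i$. For partitions $\mu\subseteq\lambda$ the skew diagram $\lambda/\mu$ consists of the cells of $\lambda$ not in $\mu$; it is a horizontal strip if no two of its cells lie in the same column. For integers $a$ let $[a]_q=(1-q^a)/(1-q)$ (so $[a]_q=1+q+\dots+q^{a-1}$ for $a\ge 0$). Let $\lambda\vdash n$, $\mu\vdash j$, $\lambda/\mu$ a horizontal strip. Let $\mathfrak{t}^{\lambda/\mu}$ be the filling of the cells of $\lambda/\mu$ with $j+1,\dots,n$ in order, going through the rows from top to bottom and within each row from left to right; for $j<\ell\le n$ let $c_\ell$ be the content of the cell containing $\ell$. Define (as a polynomial/Laurent polynomial in $q$, $q$ being an indeterminate or a nonzero scalar) $$\mathcal{E}_{\lambda/\mu}(k)=q^{nk-\binom k2}\sum_{j<\ell_1<\ell_2<\cdots<\ell_k\le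 n}\ \prod_{m=1}^k q^{ -\ell_m}\,[\ell_m+1-m+c_{\ell_m}]_q .$$ -}

module Defs where

open import Algebra.Bundles using (CommutativeRing)
open import Data.Nat as ℕ using (ℕ; zero; suc; _≤_; _∸_)
open import Data.Nat.Combinatorics using (_C_)
open import Data.Integer as ℤ using (ℤ; +_; -[1+_])
open import Data.List using (List; []; _∷_; _++_; map; concatMap; upTo; zip; length)
open import Data.Nat.ListAction using (sum)
open import Data.List.Relation.Unary.All using (All)
open import Data.Product using (_×_; _,_)

-- Partitions are lists of natural numbers (row lengths, top to bottom).
-- `at p i` is the i-th part (0-indexed), 0 beyond the length.
at : List ℕ → ℕ → ℕ
at []       _       = 0
at (x ∷ xs) zero    = x
at (x ∷ xs) (suc i) = at xs i

IsPartition : List ℕ → Set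
IsPartition p = All (ℕ._<_ 0) p × (∀ i → at p (suc i) ≤ at p i)

size : List ℕ → ℕ
size = sum

_⊆ₚ_ : List ℕ → List ℕ → Set
μ ⊆ₚ la = ∀ i → at μ i ≤ at la i

-- λ/μ is a horizontal strip (with μ ⊆ λ): no two cells of λ/μ in one column,
-- i.e. λ_{i+1} ≤ μ_i for all i.
IsHorizontalStrip : List ℕ → List ℕ → Set
IsHorizontalStrip la μ = (μ ⊆ₚ la) × (∀ i → at la (suc i) ≤ at μ i)

-- cells (row , column), 0-indexed, of row r between columns a (incl.) and b (excl.)
rowCells : ℕ → ℕ → ℕ → List (ℕ × ℕ)
rowCells r a b = map (λ t → r , a ℕ.+ t) (upTo (b ∸ a))

-- The cells of λ/μ in the order of the filling t^{λ/μ}: rows top to bottom,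
-- each row left to right. The t-th element (0-indexed) contains j+1+t.
stripCells : List ℕ → List ℕ → List (ℕ × ℕ)
stripCells la μ = concatMap (λ i → rowCells i (at μ i) (at la i)) (upTo (length la))

content : ℕ × ℕ → ℤ
content (r , c) = + c ℤ.- + r

removeCell : ℕ → List ℕ → List ℕ
removeCell _       []             = []
removeCell zero    (suc zero ∷ xs) = xs
removeCell zero    (x ∷ xs)       = ℕ.pred x ∷ xs
removeCell (suc r) (x ∷ xs)       = x ∷ removeCell r xs

choose : {A : Set} → ℕ → List A → List (List A)
choose zero    _        = [] ∷ []
choose (suc k) []       = []
choose (suc k) (x ∷ xs) = map (x ∷_) (choose k xs) ++ choose (suc k) xs

-- Ring-valued part. q is a unit (q * q⁻ ≈ 1); this covers q an indeterminate
-- (R = ℤ[q,q⁻¹]) as well as q a nonzero scalar in a field.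
module WithRing {c ℓ} (R : CommutativeRing c ℓ) (q q⁻ : CommutativeRing.Carrier R) where
  open CommutativeRing R

  pow : Carrier → ℕ → Carrier
  pow x zero    = 1#
  pow x (suc n) = x * pow x n

  zpow : ℤ → Carrier
  zpow (+ n)      = pow q n
  zpow -[1+ n ]   = pow q⁻ (suc n)

  geom : Carrier → ℕ → ℕ → Carrier
  geom x s zero    = 0#
  geom x s (suc n) = pow x s + geom x (suc s) n

  -- [a]_q = (1 - q^a)/(1 - q):  [n]_q = 1 + … + q^{n-1},
  -- [-m]_q = -(q^{-1} + … + q^{-m})
  qint : ℤ → Carrier
  qint (+ n)      = geom q 0 n
  qint -[1+ n ]   = - geom q⁻ 1 (suc n)

  termProd : ℕ → List (ℕ × ℤ) → Carrier
  termProd m []            = 1#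
  termProd m ((l , c) ∷ r) =
    (zpow (ℤ.- (+ l)) * qint (+ l ℤ.+ + 1 ℤ.- + m ℤ.+ c)) * termProd (suc m) r

  sumR : List Carrier → Carrier
  sumR []       = 0#
  sumR (x ∷ xs) = x + sumR xs

  -- the labels j+1, …, n together with their contents c_ℓ
  labelled : List ℕ → List ℕ → List (ℕ × ℤ)
  labelled la μ =
    let cs = stripCells la μ in
    zip (map (λ t → suc (size μ ℕ.+ t)) (upTo (length cs))) (map content cs)

  E : List ℕ → List ℕ → ℕ → Carrier
  E la μ k =
    zpow (+ (size la ℕ.* k) ℤ.- + (k C 2))
      * sumR (map (termProd 1) (choose k (labelled la μ)))

-- The cell of λ/μ holding n is the last cell of the filling, so deleting it leaves the filling of
-- λ′/μ: the labelled contents of λ/μ are those of λ′/μ followed by (n , c). Write S_k for the sum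
-- in 𝓔(k). Splitting the k-subsets ℓ₁ < ⋯ < ℓ_k by whether ℓ_k = n (n can only be the last one) gives
--   S_k(λ/μ) = S_k(λ′/μ) + q^{-n} [n+1-k+c]_q S_{k-1}(λ′/μ),
-- and the prefactors match since nk - C(k,2) = k + ((n-1)k - C(k,2)) = n + ((n-1)(k-1) - C(k-1,2)).
module Submission where

open import Defs
open import Algebra.Bundles using (CommutativeRing)
open import Data.Nat as ℕ using (ℕ; zero; suc; _∸_; _<_)
open import Data.Integer using (ℤ; +_; -[1+_])
import Data.Integer as ℤ
open import Data.List using (List; []; _∷_; _∷ʳ_)
open import Data.Product using (_×_; _,_)
open import Relation.Binary.PropositionalEquality using (_≡_; _≢_)
import Relation.Binary.PropositionalEquality as ≡

module Combinatorics where

  open import Algebra.Bundles using (CommutativeMonoid)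
  open import Data.Nat using (_+_; _≤_; z≤n; s≤s; _≤?_)
  open import Data.Nat.Properties
    using (+-suc; suc-injective; +-identityʳ; m+[n∸m]≡n; m≤n⇒m∸n≡0; +-∸-assoc;
           <-≤-trans; ≤-<-trans; ≤-trans; ≤-refl; ≤-reflexive; <-irrefl; ≰⇒>; +-commutativeSemigroup)
  open import Data.List
    using (_++_; [_]; map; concatMap; upTo; applyUpTo; length; drop; zip; initLast; _∷ʳ′_)
  open import Data.List.Properties
    using (map-++; map-∘; length-++; length-map; length-upTo; upTo-∷ʳ; map-upTo;
           concatMap-map; concatMap-cong; map-concatMap; ∷ʳ-injective; ++-assoc; ++-identityʳ)
  open import Data.List.Membership.Propositional using (_∈_)
  open import Data.List.Membership.Propositional.Properties using (∈-++⁻; ∈-++⁺ʳ; ∈-map⁻; ∈-upTo⁻)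
  open import Data.List.Relation.Unary.All as All using (All; []; _∷_)
  import Data.List.Relation.Unary.All.Properties as All
  open import Data.List.Relation.Binary.Permutation.Propositional using (_↭_; ↭-refl; ↭-prep; module PermutationReasoning)
  import Data.List.Relation.Binary.Permutation.Propositional.Properties as ↭
  open import Data.List.Relation.Unary.Any using (here)
  open import Data.Product using (map₁)
  open import Data.Sum using (inj₁; inj₂)
  open import Data.Empty using (⊥-elim)
  open import Relation.Nullary using (yes; no)
  open import Relation.Binary.PropositionalEquality using (_≡_; _≢_; refl; sym; subst; trans; cong; cong₂; module ≡-Reasoning)
  open import Algebra.Properties.CommutativeSemigroup +-commutativeSemigroup using (interchange)

  at-drop1 : ∀ μ i → at (drop 1 μ) i ≡ at μ (suc i)
  at-drop1 []      i = refl
  at-drop1 (_ ∷ _) i = refl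

  size-drop1 : ∀ μ → size μ ≡ at μ 0 + size (drop 1 μ)
  size-drop1 []      = refl
  size-drop1 (_ ∷ _) = refl

  ⊆ₚ[]⇒size≡0 : ∀ μ → μ ⊆ₚ [] → size μ ≡ 0
  ⊆ₚ[]⇒size≡0 []      _ = refl
  ⊆ₚ[]⇒size≡0 (x ∷ μ) μ⊆[] with μ⊆[] 0
  ... | z≤n = ⊆ₚ[]⇒size≡0 μ (λ i → μ⊆[] (suc i))

  m<n∸o⇒o+m<n : ∀ {m n} o → m < n ∸ o → o + m < n
  m<n∸o⇒o+m<n             zero    m<n   = m<n
  m<n∸o⇒o+m<n {n = suc n} (suc o) m<n∸o = s≤s (m<n∸o⇒o+m<n o m<n∸o)

  length-rowCells : ∀ r a b → length (rowCells r a b) ≡ b ∸ a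
  length-rowCells r a b = trans (length-map _ (upTo (b ∸ a))) (length-upTo (b ∸ a))

  rowCells-empty : ∀ r {a b} → b ≤ a → rowCells r a b ≡ []
  rowCells-empty r b≤a rewrite m≤n⇒m∸n≡0 b≤a = refl

  rowCells-suc : ∀ r {a b} → a ≤ b → rowCells r a (suc b) ≡ rowCells r a b ∷ʳ (r , b)
  rowCells-suc r {a} {b} a≤b = begin
    map cell (upTo (suc b ∸ a))           ≡⟨ cong (λ d → map cell (upTo d)) (+-∸-assoc 1 a≤b) ⟩
    map cell (upTo (suc (b ∸ a)))         ≡⟨ cong (map cell) (upTo-∷ʳ (b ∸ a)) ⟨
    map cell (upTo (b ∸ a) ∷ʳ (b ∸ a))    ≡⟨ map-++ cell (upTo (b ∸ a)) [ b ∸ a ] ⟩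
    rowCells r a b ∷ʳ (r , a + (b ∸ a))   ≡⟨ cong (λ c → rowCells r a b ∷ʳ (r , c)) (m+[n∸m]≡n a≤b) ⟩
    rowCells r a b ∷ʳ (r , b)             ∎
    where
    open ≡-Reasoning
    cell : ℕ → ℕ × ℕ
    cell t = r , a + t

  rowCells-nextRow : ∀ r a b → rowCells (suc r) a b ≡ map (map₁ suc) (rowCells r a b)
  rowCells-nextRow r a b = map-∘ (upTo (b ∸ a))

  stripCells-∷ : ∀ x xs μ →
    stripCells (x ∷ xs) μ ≡ rowCells 0 (at μ 0) x ++ map (map₁ suc) (stripCells xs (drop 1 μ))
  stripCells-∷ x xs μ = cong (rowCells 0 (at μ 0) x ++_) (begin
    concatMap row (applyUpTo suc (length xs))          ≡⟨ cong (concatMap row) (map-upTo suc (length xs)) ⟨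
    concatMap row (map suc (upTo (length xs)))         ≡⟨ concatMap-map row suc (upTo (length xs)) ⟩
    concatMap (λ i → row (suc i)) (upTo (length xs))   ≡⟨ concatMap-cong row-suc (upTo (length xs)) ⟩
    concatMap (λ i → map (map₁ suc) (row′ i)) (upTo (length xs)) ≡⟨ map-concatMap (map₁ suc) row′ (upTo (length xs)) ⟨
    map (map₁ suc) (stripCells xs (drop 1 μ))          ∎)
    where
    open ≡-Reasoning
    row row′ : ℕ → List (ℕ × ℕ)
    row i = rowCells i (at μ i) (at (x ∷ xs) i)
    row′ i = rowCells i (at (drop 1 μ) i) (at xs i)
    row-suc : ∀ i → row (suc i) ≡ map (map₁ suc) (row′ i)
    row-suc i rewrite at-drop1 μ i = rowCells-nextRow i (at μ (suc i)) (at xs i)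

  stripCells-self : ∀ la → stripCells la la ≡ []
  stripCells-self []       = refl
  stripCells-self (x ∷ xs) = begin
    stripCells (x ∷ xs) (x ∷ xs)                 ≡⟨ stripCells-∷ x xs (x ∷ xs) ⟩
    rowCells 0 x x ++ map (map₁ suc) (stripCells xs xs)
      ≡⟨ cong₂ (λ row rest → row ++ map (map₁ suc) rest) (rowCells-empty 0 ≤-refl) (stripCells-self xs) ⟩
    []                                           ∎
    where open ≡-Reasoning

  length-stripCells : ∀ la μ → μ ⊆ₚ la → size μ + length (stripCells la μ) ≡ size la
  length-stripCells []       μ μ⊆[]  = trans (+-identityʳ (size μ)) (⊆ₚ[]⇒size≡0 μ μ⊆[])
  length-stripCells (x ∷ xs) μ μ⊆la = begin
    size μ + length (stripCells (x ∷ xs) μ)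
      ≡⟨ cong₂ _+_ (size-drop1 μ) (cong length (stripCells-∷ x xs μ)) ⟩
    (a + size μ′) + length (rowCells 0 a x ++ map (map₁ suc) rest)
      ≡⟨ cong (_+_ (a + size μ′)) (trans (length-++ (rowCells 0 a x)) (cong₂ _+_ (length-rowCells 0 a x) (length-map _ rest))) ⟩
    (a + size μ′) + ((x ∸ a) + length rest)
      ≡⟨ interchange a (size μ′) (x ∸ a) (length rest) ⟩
    (a + (x ∸ a)) + (size μ′ + length rest)
      ≡⟨ cong₂ _+_ (m+[n∸m]≡n (μ⊆la 0)) (length-stripCells xs μ′ μ′⊆xs) ⟩
    x + size xs ∎
    where
    open ≡-Reasoning
    a = at μ 0
    μ′ = drop 1 μ
    rest = stripCells xs μ′
    μ′⊆xs : μ′ ⊆ₚ xs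
    μ′⊆xs i = ≤-trans (≤-reflexive (at-drop1 μ i)) (μ⊆la (suc i))

  ∈-stripCells⇒< : ∀ la μ {r c} → (r , c) ∈ stripCells la μ → c < at la r
  ∈-stripCells⇒< (x ∷ xs) μ p rewrite stripCells-∷ x xs μ
    with ∈-++⁻ (rowCells 0 (at μ 0) x) p
  ... | inj₁ p₁ with t , t∈ , refl ← ∈-map⁻ _ p₁ = m<n∸o⇒o+m<n (at μ 0) (∈-upTo⁻ t∈)
  ... | inj₂ p₂ with _ , p′ , refl ← ∈-map⁻ _ p₂ = ∈-stripCells⇒< xs (drop 1 μ) p′

  size-removeCell : ∀ r la → 0 < at la r → suc (size (removeCell r la)) ≡ size la
  size-removeCell zero    (suc zero ∷ xs)    _ = refl
  size-removeCell zero    (suc (suc x) ∷ xs) _ = refl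
  size-removeCell (suc r) (x ∷ xs)           p = trans (sym (+-suc x _)) (cong (_+_ x) (size-removeCell r xs p))

  []≢∷ʳ : ∀ {A : Set} {xs : List A} {x} → [] ≢ xs ∷ʳ x
  []≢∷ʳ {xs = []}    ()
  []≢∷ʳ {xs = _ ∷ _} ()

  ++-map-∷ʳ : ∀ {A B : Set} (xs : List B) (f : A → B) ys y → (xs ++ map f ys) ∷ʳ f y ≡ xs ++ map f (ys ∷ʳ y)
  ++-map-∷ʳ xs f ys y = trans (++-assoc xs (map f ys) [ f y ]) (cong (xs ++_) (sym (map-++ f ys [ y ])))

  rowCells-∷ʳ⁻ : ∀ r {a b cs z} → rowCells r a (suc b) ≡ cs ∷ʳ z → a ≤ b × cs ≡ rowCells r a b × z ≡ (r , b)
  rowCells-∷ʳ⁻ r {a} {b} eq with a ≤? b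
  ... | no  a≰b = ⊥-elim ([]≢∷ʳ (trans (sym (rowCells-empty r (≰⇒> a≰b))) eq))
  ... | yes a≤b with cs≡ , z≡ ← ∷ʳ-injective _ _ (trans (sym (rowCells-suc r a≤b)) eq) = a≤b , sym cs≡ , sym z≡

  -- For x = 1 the row disappears; positivity and xs₀ ≤ μ₀ = 0 then force xs = [], so no row moves up.
  lastRow-removeCell : ∀ x xs μ {cs r c} → 0 < x → All (0 <_) xs → at xs 0 ≤ at μ 0 →
    stripCells xs (drop 1 μ) ≡ [] → rowCells 0 (at μ 0) x ≡ cs ∷ʳ (r , c) →
    stripCells (removeCell r (x ∷ xs)) μ ≡ cs
  lastRow-removeCell (suc zero) [] μ _ _ _ _ eq with _ , refl , refl ← rowCells-∷ʳ⁻ 0 eq =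
    sym (rowCells-empty 0 z≤n)
  lastRow-removeCell (suc zero) (y ∷ ys) μ _ (y>0 ∷ _) y≤a _ eq with a≤0 , _ , _ ← rowCells-∷ʳ⁻ 0 eq =
    ⊥-elim (<-irrefl refl (<-≤-trans y>0 (≤-trans y≤a a≤0)))
  lastRow-removeCell (suc (suc e)) xs μ _ _ _ below≡[] eq with _ , refl , refl ← rowCells-∷ʳ⁻ 0 eq = begin
    stripCells (suc e ∷ xs) μ                                  ≡⟨ stripCells-∷ (suc e) xs μ ⟩
    row ++ map (map₁ suc) (stripCells xs (drop 1 μ))            ≡⟨ cong (λ S → row ++ map (map₁ suc) S) below≡[] ⟩
    row ++ []                                                  ≡⟨ ++-identityʳ row ⟩
    row                                                        ∎
    where
    open ≡-Reasoning
    row = rowCells 0 (at μ 0) (suc e)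

  stripCells-removeCell : ∀ la μ {cs r c} → All (0 <_) la → (∀ i → at la (suc i) ≤ at μ i) →
    stripCells la μ ≡ cs ∷ʳ (r , c) → stripCells (removeCell r la) μ ≡ cs
  stripCells-removeCell [] μ _ _ eq = ⊥-elim ([]≢∷ʳ eq)
  stripCells-removeCell (x ∷ xs) μ (x>0 ∷ xs>0) strip eq
    rewrite stripCells-∷ x xs μ
    with stripCells xs (drop 1 μ) in below | initLast (stripCells xs (drop 1 μ))
  ... | _ | [] = lastRow-removeCell x xs μ x>0 xs>0 (strip 0) below (trans (sym (++-identityʳ _)) eq)
  ... | _ | S ∷ʳ′ (r′ , c′) with refl , refl ← ∷ʳ-injective _ _ (trans (++-map-∷ʳ _ (map₁ suc) S _) eq) = begin
    stripCells (x ∷ removeCell r′ xs) μ                           ≡⟨ stripCells-∷ x (removeCell r′ xs) μ ⟩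
    row ++ map (map₁ suc) (stripCells (removeCell r′ xs) (drop 1 μ))
      ≡⟨ cong (λ T → row ++ map (map₁ suc) T) (stripCells-removeCell xs (drop 1 μ) xs>0 strip′ below) ⟩
    row ++ map (map₁ suc) S                                       ∎
    where
    open ≡-Reasoning
    row = rowCells 0 (at μ 0) x
    strip′ : ∀ i → at xs (suc i) ≤ at (drop 1 μ) i
    strip′ i = ≤-trans (strip (suc i)) (≤-reflexive (sym (at-drop1 μ i)))

  length-∷ʳ : ∀ {A : Set} (xs : List A) x → length (xs ∷ʳ x) ≡ suc (length xs)
  length-∷ʳ []       x = refl
  length-∷ʳ (_ ∷ xs) x = cong suc (length-∷ʳ xs x)

  zip-∷ʳ : ∀ {A B : Set} (xs : List A) (ys : List B) x y →
    length xs ≡ length ys → zip (xs ∷ʳ x) (ys ∷ʳ y) ≡ zip xs ys ∷ʳ (x , y)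
  zip-∷ʳ []       []       x y _  = refl
  zip-∷ʳ (a ∷ xs) (b ∷ ys) x y eq = cong ((a , b) ∷_) (zip-∷ʳ xs ys x y (suc-injective eq))

  -- WithRing.labelled la μ is labels (size μ) (stripCells la μ) by definition.
  labels : ℕ → List (ℕ × ℕ) → List (ℕ × ℤ)
  labels j cs = zip (map (λ t → suc (j + t)) (upTo (length cs))) (map content cs)

  labels-∷ʳ : ∀ j cs z → labels j (cs ∷ʳ z) ≡ labels j cs ∷ʳ (suc (j + length cs) , content z)
  labels-∷ʳ j cs z = begin
    zip (map label (upTo (length (cs ∷ʳ z)))) (map content (cs ∷ʳ z))
      ≡⟨ cong₂ zip (cong (λ m → map label (upTo m)) (length-∷ʳ cs z)) (map-++ content cs [ z ]) ⟩
    zip (map label (upTo (suc (length cs)))) (map content cs ∷ʳ content z)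
      ≡⟨ cong (λ ts → zip (map label ts) (map content cs ∷ʳ content z)) (upTo-∷ʳ (length cs)) ⟨
    zip (map label (upTo (length cs) ∷ʳ length cs)) (map content cs ∷ʳ content z)
      ≡⟨ cong (λ ls → zip ls (map content cs ∷ʳ content z)) (map-++ label (upTo (length cs)) [ length cs ]) ⟩
    zip (map label (upTo (length cs)) ∷ʳ label (length cs)) (map content cs ∷ʳ content z)
      ≡⟨ zip-∷ʳ _ _ _ _ same-length ⟩
    labels j cs ∷ʳ (label (length cs) , content z) ∎
    where
    open ≡-Reasoning
    label : ℕ → ℕ
    label t = suc (j + t)
    same-length : length (map label (upTo (length cs))) ≡ length (map content cs)
    same-length = trans (length-map label (upTo (length cs))) (trans (length-upTo (length cs)) (sym (length-map content cs)))

  labels-removeCell : ∀ la μ {cs r c} → IsPartition la → IsHorizontalStrip la μ →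
    stripCells la μ ≡ cs ∷ʳ (r , c) →
    labels (size μ) (stripCells la μ) ≡ labels (size μ) (stripCells (removeCell r la) μ) ∷ʳ (size la , content (r , c))
  labels-removeCell la μ {cs} {r} {c} (la>0 , _) (μ⊆la , strip) eq = begin
    labels (size μ) (stripCells la μ)      ≡⟨ cong (labels (size μ)) eq ⟩
    labels (size μ) (cs ∷ʳ (r , c))         ≡⟨ labels-∷ʳ (size μ) cs (r , c) ⟩
    labels (size μ) cs ∷ʳ (suc (size μ + length cs) , content (r , c))
      ≡⟨ cong₂ (λ cs′ n → labels (size μ) cs′ ∷ʳ (n , content (r , c))) (sym (stripCells-removeCell la μ la>0 strip eq)) size≡ ⟩
    labels (size μ) (stripCells (removeCell r la) μ) ∷ʳ (size la , content (r , c)) ∎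
    where
    open ≡-Reasoning
    size≡ : suc (size μ + length cs) ≡ size la
    size≡ = begin
      suc (size μ + length cs)          ≡⟨ +-suc (size μ) (length cs) ⟨
      size μ + suc (length cs)          ≡⟨ cong (_+_ (size μ)) (length-∷ʳ cs (r , c)) ⟨
      size μ + length (cs ∷ʳ (r , c))   ≡⟨ cong (λ cells → size μ + length cells) eq ⟨
      size μ + length (stripCells la μ) ≡⟨ length-stripCells la μ μ⊆la ⟩
      size la                           ∎

  size-removeCell-last : ∀ la μ {cs r c} → stripCells la μ ≡ cs ∷ʳ (r , c) → suc (size (removeCell r la)) ≡ size la
  size-removeCell-last la μ {cs} eq =
    size-removeCell _ la (≤-<-trans z≤n (∈-stripCells⇒< la μ (subst (_ ∈_) (sym eq) (∈-++⁺ʳ cs (here refl)))))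

  module _ {A : Set} where
    open import Algebra.Properties.CommutativeSemigroup
      (CommutativeMonoid.commutativeSemigroup (↭.++-commutativeMonoid {A = List A}))
      renaming (interchange to ++-interchange)
    open PermutationReasoning

    choose-∷ʳ : ∀ k (xs : List A) x →
      choose (suc k) (xs ∷ʳ x) ↭ choose (suc k) xs ++ map (_∷ʳ x) (choose k xs)
    choose-∷ʳ zero    []       x = ↭-refl
    choose-∷ʳ (suc k) []       x = ↭-refl
    choose-∷ʳ zero    (y ∷ ys) x = ↭-prep [ y ] (choose-∷ʳ zero ys x)
    choose-∷ʳ (suc k) (y ∷ ys) x = begin
      map (y ∷_) (choose (suc k) (ys ∷ʳ x)) ++ choose (suc (suc k)) (ys ∷ʳ x)
        ↭⟨ ↭.++⁺ (↭.map⁺ (y ∷_) (choose-∷ʳ k ys x)) (choose-∷ʳ (suc k) ys x) ⟩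
      map (y ∷_) (A₁ ++ B₁) ++ (A₂ ++ B₂)
        ≡⟨ cong (_++ (A₂ ++ B₂)) (map-++ (y ∷_) A₁ B₁) ⟩
      (map (y ∷_) A₁ ++ map (y ∷_) B₁) ++ (A₂ ++ B₂)
        ↭⟨ ++-interchange (map (y ∷_) A₁) (map (y ∷_) B₁) A₂ B₂ ⟩
      (map (y ∷_) A₁ ++ A₂) ++ (map (y ∷_) B₁ ++ B₂)
        ≡⟨ cong (λ B → (map (y ∷_) A₁ ++ A₂) ++ (B ++ B₂)) (trans (sym (map-∘ (choose k ys))) (map-∘ (choose k ys))) ⟩
      (map (y ∷_) A₁ ++ A₂) ++ (map (_∷ʳ x) (map (y ∷_) (choose k ys)) ++ B₂)
        ≡⟨ cong ((map (y ∷_) A₁ ++ A₂) ++_) (map-++ (_∷ʳ x) (map (y ∷_) (choose k ys)) (choose (suc k) ys)) ⟨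
      choose (suc (suc k)) (y ∷ ys) ++ map (_∷ʳ x) (choose (suc k) (y ∷ ys)) ∎
      where
      A₁ = choose (suc k) ys
      B₁ = map (_∷ʳ x) (choose k ys)
      A₂ = choose (suc (suc k)) ys
      B₂ = map (_∷ʳ x) (choose (suc k) ys)

    choose-length : ∀ k (xs : List A) → All (λ s → length s ≡ k) (choose k xs)
    choose-length zero    xs       = refl ∷ []
    choose-length (suc k) []       = []
    choose-length (suc k) (x ∷ xs) =
      All.++⁺ (All.map⁺ (All.map (cong suc) (choose-length k xs))) (choose-length (suc k) xs)

module Exponent where

  open import Data.Nat using (_+_; _*_)
  open import Data.Nat.Combinatorics using (_C_; nC1≡n; nCk+nC[k+1]≡[n+1]C[k+1])
  open import Data.Integer.Properties using (pos-+; pos-*; +-assoc)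
  open import Data.Integer.Tactic.RingSolver using (solve-∀)
  open import Relation.Binary.PropositionalEquality using (sym; trans; cong; cong₂; module ≡-Reasoning)

  exponent : ℕ → ℕ → ℤ
  exponent n k = + (n * k) ℤ.- + (k C 2)

  [1+n]C2 : ∀ n → suc n C 2 ≡ n + n C 2
  [1+n]C2 n = trans (sym (nCk+nC[k+1]≡[n+1]C[k+1] n 1)) (cong (_+ n C 2) (nC1≡n n))

  exponent-suc : ∀ n k → exponent (suc n) k ≡ + k ℤ.+ exponent n k
  exponent-suc n k = trans (cong (ℤ._- + (k C 2)) (pos-+ k (n * k))) (+-assoc (+ k) (+ (n * k)) (ℤ.- + (k C 2)))

  exponent-suc-suc : ∀ n k → exponent (suc n) (suc k) ℤ.+ -[1+ n ] ≡ exponent n k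
  exponent-suc-suc n k = begin
    exponent (suc n) (suc k) ℤ.+ -[1+ n ]
      ≡⟨ cong (ℤ._+ -[1+ n ]) (cong₂ ℤ._-_ (pos-* (suc n) (suc k)) (trans (cong +_ ([1+n]C2 k)) (pos-+ k (k C 2)))) ⟩
    ((ℤ.1ℤ ℤ.+ + n) ℤ.* (ℤ.1ℤ ℤ.+ + k) ℤ.- (+ k ℤ.+ + (k C 2))) ℤ.+ ℤ.- (ℤ.1ℤ ℤ.+ + n)
      ≡⟨ identity (+ n) (+ k) (+ (k C 2)) ⟩
    + n ℤ.* + k ℤ.- + (k C 2)
      ≡⟨ cong (ℤ._- + (k C 2)) (pos-* n k) ⟨
    exponent n k ∎
    where
    open ≡-Reasoning
    identity : ∀ a b c → ((ℤ.1ℤ ℤ.+ a) ℤ.* (ℤ.1ℤ ℤ.+ b) ℤ.- (b ℤ.+ c)) ℤ.+ ℤ.- (ℤ.1ℤ ℤ.+ a) ≡ a ℤ.* b ℤ.- c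
    identity = solve-∀

module Expansion {c ℓ} (R : CommutativeRing c ℓ) (q q⁻ : CommutativeRing.Carrier R) where

  open CommutativeRing R
  open WithRing R q q⁻
  open Combinatorics using (choose-∷ʳ; choose-length; labels; stripCells-self; labels-removeCell; size-removeCell-last)
  open Exponent using (exponent; exponent-suc; exponent-suc-suc)
  open import Data.List using (_++_; map; foldr; length)
  open import Data.List.Properties using (map-++; map-∘)
  open import Data.List.Relation.Unary.All as All using (All; []; _∷_)
  open import Data.List.Relation.Binary.Permutation.Propositional using (_↭_; ↭⇒↭ₛ′)
  import Data.List.Relation.Binary.Permutation.Propositional.Properties as ↭
  open import Data.List.Relation.Binary.Permutation.Setoid.Properties setoid using (foldr-commMonoid)
  import Data.Integer.Properties as ℤ
  import Data.Nat.Properties as ℕ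
  open import Relation.Binary.Reasoning.Setoid setoid
  open import Relation.Binary.PropositionalEquality using (_≗_)
  open import Algebra.Properties.CommutativeSemigroup *-commutativeSemigroup using (interchange)
  import Algebra.Solver.CommutativeMonoid *-commutativeMonoid as *-Solver

  sumR≗foldr : sumR ≗ foldr _+_ 0#
  sumR≗foldr []       = ≡.refl
  sumR≗foldr (x ∷ xs) = ≡.cong (_+_ x) (sumR≗foldr xs)

  sumR-↭ : ∀ {xs ys} → xs ↭ ys → sumR xs ≈ sumR ys
  sumR-↭ {xs} {ys} p = begin
    sumR xs           ≡⟨ sumR≗foldr xs ⟩
    foldr _+_ 0# xs   ≈⟨ foldr-commMonoid +-isCommutativeMonoid (↭⇒↭ₛ′ isEquivalence p) ⟩
    foldr _+_ 0# ys   ≡⟨ sumR≗foldr ys ⟨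
    sumR ys           ∎

  sumR-++ : ∀ xs ys → sumR (xs ++ ys) ≈ sumR xs + sumR ys
  sumR-++ []       ys = sym (+-identityˡ _)
  sumR-++ (x ∷ xs) ys = trans (+-congˡ (sumR-++ xs ys)) (sym (+-assoc _ _ _))

  sumR-map-*ʳ : ∀ {A : Set} (f : A → Carrier) a xs → sumR (map (λ s → f s * a) xs) ≈ sumR (map f xs) * a
  sumR-map-*ʳ f a []       = sym (zeroˡ a)
  sumR-map-*ʳ f a (x ∷ xs) = trans (+-congˡ (sumR-map-*ʳ f a xs)) (sym (distribʳ a _ _))

  sumR-map-cong : ∀ {A : Set} {f g : A → Carrier} {xs} → All (λ s → f s ≈ g s) xs → sumR (map f xs) ≈ sumR (map g xs)
  sumR-map-cong []         = refl
  sumR-map-cong (fx≈gx ∷ p) = +-cong fx≈gx (sumR-map-cong p)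

  termFactor : ℕ → ℕ × ℤ → Carrier
  termFactor m (l , c) = zpow (ℤ.- (+ l)) * qint (+ l ℤ.+ + 1 ℤ.- + m ℤ.+ c)

  termProd-∷ʳ : ∀ m s x → termProd m (s ∷ʳ x) ≈ termProd m s * termFactor (m ℕ.+ length s) x
  termProd-∷ʳ m []      x rewrite ℕ.+-identityʳ m = *-comm _ _
  termProd-∷ʳ m (y ∷ s) x = begin
    termFactor m y * termProd (suc m) (s ∷ʳ x)                   ≈⟨ *-congˡ (termProd-∷ʳ (suc m) s x) ⟩
    termFactor m y * (termProd (suc m) s * termFactor (suc m ℕ.+ length s) x) ≈⟨ *-assoc _ _ _ ⟨
    termProd m (y ∷ s) * termFactor (suc (m ℕ.+ length s)) x     ≡⟨ ≡.cong (λ j → termProd m (y ∷ s) * termFactor j x) (ℕ.+-suc m (length s)) ⟨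
    termProd m (y ∷ s) * termFactor (m ℕ.+ length (y ∷ s)) x     ∎

  Σchoose : ℕ → List (ℕ × ℤ) → Carrier
  Σchoose k L = sumR (map (termProd 1) (choose k L))

  Σchoose-∷ʳ : ∀ k L x → Σchoose (suc k) (L ∷ʳ x) ≈ Σchoose (suc k) L + Σchoose k L * termFactor (suc k) x
  Σchoose-∷ʳ k L x = begin
    sumR (map (termProd 1) (choose (suc k) (L ∷ʳ x)))
      ≈⟨ sumR-↭ (↭.map⁺ (termProd 1) (choose-∷ʳ k L x)) ⟩
    sumR (map (termProd 1) (choose (suc k) L ++ map (_∷ʳ x) (choose k L)))
      ≡⟨ ≡.cong sumR (map-++ (termProd 1) (choose (suc k) L) (map (_∷ʳ x) (choose k L))) ⟩
    sumR (map (termProd 1) (choose (suc k) L) ++ map (termProd 1) (map (_∷ʳ x) (choose k L)))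
      ≈⟨ sumR-++ (map (termProd 1) (choose (suc k) L)) _ ⟩
    Σchoose (suc k) L + sumR (map (termProd 1) (map (_∷ʳ x) (choose k L)))
      ≡⟨ ≡.cong (λ ts → Σchoose (suc k) L + sumR ts) (map-∘ (choose k L)) ⟨
    Σchoose (suc k) L + sumR (map (λ s → termProd 1 (s ∷ʳ x)) (choose k L))
      ≈⟨ +-congˡ (sumR-map-cong (All.map (λ {s} → last-factor {s}) (choose-length k L))) ⟩
    Σchoose (suc k) L + sumR (map (λ s → termProd 1 s * termFactor (suc k) x) (choose k L))
      ≈⟨ +-congˡ (sumR-map-*ʳ (termProd 1) (termFactor (suc k) x) (choose k L)) ⟩
    Σchoose (suc k) L + Σchoose k L * termFactor (suc k) x ∎
    where
    last-factor : ∀ {s} → length s ≡ k → termProd 1 (s ∷ʳ x) ≈ termProd 1 s * termFactor (suc k) x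
    last-factor {s} |s|≡k =
      ≡.subst (λ j → termProd 1 (s ∷ʳ x) ≈ termProd 1 s * termFactor (suc j) x) |s|≡k (termProd-∷ʳ 1 s x)

  -- E la μ k is ℰ (size la) (labelled la μ) k by definition.
  ℰ : ℕ → List (ℕ × ℤ) → ℕ → Carrier
  ℰ n L k = zpow (exponent n k) * Σchoose k L

  E-zero : ∀ la μ → E la μ 0 ≈ 1#
  E-zero la μ rewrite ℕ.*-zeroʳ (size la) = trans (*-identityˡ _) (+-identityʳ _)

  E-self : ∀ la k → E la la (suc k) ≈ 0#
  E-self la k =
    trans (*-congˡ (reflexive (≡.cong (λ cells → Σchoose (suc k) (labels (size la) cells)) (stripCells-self la))))
          (zeroʳ _)

  pow-+ : ∀ x m n → pow x (m ℕ.+ n) ≈ pow x m * pow x n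
  pow-+ x zero    n = sym (*-identityˡ _)
  pow-+ x (suc m) n = trans (*-congˡ (pow-+ x m n)) (sym (*-assoc _ _ _))

  module _ (q*q⁻≈1 : q * q⁻ ≈ 1#) where

    zpow-⊖ : ∀ m n → zpow (m ℤ.⊖ n) ≈ pow q m * pow q⁻ n
    zpow-⊖ m       zero    rewrite ℤ.⊖-≥ (ℕ.z≤n {m}) = sym (*-identityʳ _)
    zpow-⊖ zero    (suc n) rewrite ℤ.⊖-< (ℕ.z<s {n}) = sym (*-identityˡ _)
    zpow-⊖ (suc m) (suc n) rewrite ℤ.[1+m]⊖[1+n]≡m⊖n m n = begin
      zpow (m ℤ.⊖ n)                        ≈⟨ zpow-⊖ m n ⟩
      pow q m * pow q⁻ n                    ≈⟨ *-identityˡ _ ⟨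
      1# * (pow q m * pow q⁻ n)             ≈⟨ *-congʳ q*q⁻≈1 ⟨
      (q * q⁻) * (pow q m * pow q⁻ n)       ≈⟨ interchange q q⁻ (pow q m) (pow q⁻ n) ⟩
      (q * pow q m) * (q⁻ * pow q⁻ n)       ∎

    zpow-+ : ∀ i j → zpow (i ℤ.+ j) ≈ zpow i * zpow j
    zpow-+ (+ m)    (+ n)    = pow-+ q m n
    zpow-+ (+ m)    -[1+ n ] = zpow-⊖ m (suc n)
    zpow-+ -[1+ m ] (+ n)    = trans (zpow-⊖ n (suc m)) (*-comm _ _)
    zpow-+ -[1+ m ] -[1+ n ] =
      trans (reflexive (≡.cong (λ e → pow q⁻ (suc e)) (≡.sym (ℕ.+-suc m n)))) (pow-+ q⁻ (suc m) (suc n))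

    ℰ-∷ʳ : ∀ {n m} L c k → n ≡ suc m →
      ℰ n (L ∷ʳ (n , c)) (suc k) ≈ pow q (suc k) * ℰ m L (suc k) + qint (+ n ℤ.+ + 1 ℤ.- + suc k ℤ.+ c) * ℰ m L k
    ℰ-∷ʳ {m = m} L c k ≡.refl = begin
      Z * Σchoose (suc k) (L ∷ʳ (suc m , c))
        ≈⟨ *-congˡ (Σchoose-∷ʳ k L (suc m , c)) ⟩
      Z * (Σchoose (suc k) L + Σchoose k L * (zpow -[1+ m ] * Q))
        ≈⟨ distribˡ Z _ _ ⟩
      Z * Σchoose (suc k) L + Z * (Σchoose k L * (zpow -[1+ m ] * Q))
        ≈⟨ +-cong (*-congʳ Z≈) (*-Solver.solve 4 (λ z t w u → z ⊕ (t ⊕ (w ⊕ u)) ⊜ u ⊕ ((z ⊕ w) ⊕ t))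
                                                refl Z (Σchoose k L) (zpow -[1+ m ]) Q) ⟩
      (pow q (suc k) * zpow (exponent m (suc k))) * Σchoose (suc k) L + Q * ((Z * zpow -[1+ m ]) * Σchoose k L)
        ≈⟨ +-cong (*-assoc _ _ _) (*-congˡ (*-congʳ Z*q⁻ⁿ⁺¹≈)) ⟩
      pow q (suc k) * ℰ m L (suc k) + Q * ℰ m L k ∎
      where
      open *-Solver using (_⊕_; _⊜_)
      Z = zpow (exponent (suc m) (suc k))
      Q = qint (+ suc m ℤ.+ + 1 ℤ.- + suc k ℤ.+ c)
      Z≈ : Z ≈ pow q (suc k) * zpow (exponent m (suc k))
      Z≈ = trans (reflexive (≡.cong zpow (exponent-suc m (suc k)))) (zpow-+ (+ suc k) (exponent m (suc k)))
      Z*q⁻ⁿ⁺¹≈ : Z * zpow -[1+ m ] ≈ zpow (exponent m k)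
      Z*q⁻ⁿ⁺¹≈ = trans (sym (zpow-+ (exponent (suc m) (suc k)) -[1+ m ])) (reflexive (≡.cong zpow (exponent-suc-suc m k)))

    E-removeCell : ∀ la μ {cs r c} k → IsPartition la → IsHorizontalStrip la μ → stripCells la μ ≡ cs ∷ʳ (r , c) →
      E la μ (suc k) ≈ pow q (suc k) * E (removeCell r la) μ (suc k)
                       + qint (+ size la ℤ.+ + 1 ℤ.- + suc k ℤ.+ content (r , c)) * E (removeCell r la) μ k
    E-removeCell la μ k la-partition λ/μ-strip eq =
      trans (reflexive (≡.cong (λ L → ℰ (size la) L (suc k)) (labels-removeCell la μ la-partition λ/μ-strip eq)))
            (ℰ-∷ʳ _ _ k (≡.sym (size-removeCell-last la μ eq)))

proposition5p11 : ∀ {c ℓ} (R : CommutativeRing c ℓ)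
    (q q⁻ : CommutativeRing.Carrier R) →
    CommutativeRing._≈_ R (CommutativeRing._*_ R q q⁻) (CommutativeRing.1# R) →
    (n k : ℕ) (λ′ μ : List ℕ) →
    IsPartition λ′ → IsPartition μ → size λ′ ≡ n → IsHorizontalStrip λ′ μ →
    (k ≡ 0 → CommutativeRing._≈_ R (WithRing.E R q q⁻ λ′ μ k) (CommutativeRing.1# R))
    × (0 < k → μ ≡ λ′ → CommutativeRing._≈_ R (WithRing.E R q q⁻ λ′ μ k) (CommutativeRing.0# R))
    × (0 < k → μ ≢ λ′ → (cs : List (ℕ × ℕ)) (r col : ℕ) →
        stripCells λ′ μ ≡ cs ∷ʳ (r , col) →
        CommutativeRing._≈_ R (WithRing.E R q q⁻ λ′ μ k)
          (CommutativeRing._+_ R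
            (CommutativeRing._*_ R (WithRing.pow R q q⁻ q k)
               (WithRing.E R q q⁻ (removeCell r λ′) μ k))
            (CommutativeRing._*_ R
               (WithRing.qint R q q⁻ (+ n Data.Integer.+ + 1 Data.Integer.- + k Data.Integer.+ content (r , col)))
               (WithRing.E R q q⁻ (removeCell r λ′) μ (k ∸ 1)))))
proposition5p11 R q q⁻ q*q⁻≈1 n zero λ′ μ _ _ _ _ =
  (λ _ → E-zero λ′ μ) , (λ ()) , (λ ())
  where open Expansion R q q⁻
proposition5p11 R q q⁻ q*q⁻≈1 n (suc k) λ′ μ λ′-partition _ ≡.refl λ′/μ-strip =
  (λ ()) ,
  (λ { _ ≡.refl → E-self λ′ k }) ,
  -- The hypothesis μ ≢ λ′ is implied by the existence of a last strip cell.
  (λ _ _ _ _ _ eq → E-removeCell q*q⁻≈1 λ′ μ k λ′-partition λ′/μ-strip eq)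
  where
  open Expansion R q q⁻
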